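{- There is no $2$-geodetic digraph with minimum out-degree at least $2$ and order $9$ whose in-degree sequence is $(1,1,2,\dots,2,3,3)$, i.e. exactly two vertices have in-degree $1$, exactly two have in-degree $3$, and all others have in-degree $2$.
   Context: A digraph is $2$-geodetic if for any two vertices $u,v$ there is at most one directed walk from $u$ to $v$ of length at most $2$. Note $9=M(2,2)+2$ with $M(2,2)=1+2+4$. The in-degree sequence is the list of in-degrees in non-decreasing order. -}

module Defs where

open import Data.Nat using (ℕ; _+_; _≤_)
open import Data.Bool using (Bool; true; false; _∧_)
open import Data.Fin using (Fin)
open import Data.Fin.Properties using (_≟_)
open import Data.List using (List; length; filter)
open import Data.List using (allFin)
open import Relation.Nullary.Decidable using (does)
open import Relation.Binary.PropositionalEquality using (_≡_)
open import Relation.Nullary using (Dec; yes; no)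
open import Data.Bool.Properties using (T?)

-- A (simple) digraph on n labelled vertices, given by its adjacency relation:
-- A u v = true iff there is an arc u → v.
Digraph : ℕ → Set
Digraph n = Fin n → Fin n → Bool

b2n : Bool → ℕ
b2n true  = 1
b2n false = 0

count : ∀ {n} → (Fin n → Bool) → ℕ
count {n} P = length (filter (λ w → T? (P w)) (allFin n))

outDeg : ∀ {n} → Digraph n → Fin n → ℕ
outDeg A u = count (λ v → A u v)

inDeg : ∀ {n} → Digraph n → Fin n → ℕ
inDeg A v = count (λ u → A u v)

walks0 : ∀ {n} → Fin n → Fin n → ℕ
walks0 u v = b2n (does (u ≟ v))

walks1 : ∀ {n} → Digraph n → Fin n → Fin n → ℕ
walks1 A u v = b2n (A u v)

walks2 : ∀ {n} → Digraph n → Fin n → Fin n → ℕ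
walks2 A u v = count (λ w → A u w ∧ A w v)

TwoGeodetic : ∀ {n} → Digraph n → Set
TwoGeodetic A = ∀ u v → walks0 u v + walks1 A u v + walks2 A u v ≤ 1

MinOutDegAtLeast : ∀ {n} → ℕ → Digraph n → Set
MinOutDegAtLeast d A = ∀ u → d ≤ outDeg A u

numInDeg : ∀ {n} → Digraph n → ℕ → ℕ
numInDeg A k = count (λ v → does (inDeg A v Data.Nat.≟ k))
  where import Data.Nat

module Submission where

-- No 2-geodetic digraph of order 9 with minimum out-degree 2 has in-degree
-- sequence (1,1,2,2,2,2,2,3,3).  In fact the argument below only uses that
-- exactly two vertices have in-degree 1.
--
-- 1. Counting: walks of length ≤ 2 from a vertex u reach every vertex at most
--    once, so 1 + d⁺(u) + Σ_{u→w} d⁺(w) ≤ n (the Moore bound).  With n = 9 and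
--    minimum out-degree 2 this forces every out-degree to be exactly 2, so each
--    vertex has an out-neighbourhood {p, q} with p < q.
-- 2. Normalisation: the depth-2 out-tree of a vertex consists of 7 distinct
--    vertices.  Extending this injection Fin 7 → Fin 9 to a permutation and
--    relabelling, we may assume 0 → 1,2; 1 → 3,4; 2 → 5,6.  Relabelling keeps
--    all hypotheses.
-- 3. Exhaustive search: assign out-neighbourhoods to vertices 3,…,8 one at a
--    time, pruning every partial assignment whose known arcs already contain a
--    loop, a digon, a 2-walk with a parallel arc, or two 2-walks between the
--    same vertices.  Every complete survivor has a number of in-degree-1
--    vertices different from 2; this check runs by evaluation, and its
--    soundness lemma turns it into a contradiction.

open import Defs
open import Data.Nat using (ℕ; zero; suc; _+_; _*_; _≤_; z≤n; s≤s; _<ᵇ_)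
import Data.Nat as ℕ
import Data.Nat.Properties as ℕP
open import Data.Fin using (Fin; zero; suc; toℕ; fromℕ; fromℕ<; inject₁; lower₁; _<_; #_)
open import Data.Fin.Properties
  using (_≟_; all?; any?; <-cmp; <⇒≢; toℕ-injective; toℕ-fromℕ; toℕ-fromℕ<; toℕ-inject₁; inject₁-injective; inject₁-lower₁)
open import Data.Fin.Permutation using (Permutation′; _⟨$⟩ʳ_; id; transpose; _∘ₚ_)
import Data.Fin.Permutation.Components as PC
open import Data.Bool using (Bool; true; false; _∧_; _∨_; not; if_then_else_; T)
open import Data.Bool.Properties using (T?; T-≡; T-∧; T-∨; ∨-comm)
open import Data.Maybe using (Maybe; just; nothing; is-just)
open import Data.Vec using (Vec; lookup; replicate; _[_]≔_; _∷_; [])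
open import Data.Vec.Properties using (lookup∘update; lookup∘update′; lookup-replicate)
open import Data.List using (List; []; _∷_; length; filter; tabulate)
open import Data.List.Relation.Unary.All using (All; []; _∷_)
open import Data.List.Relation.Unary.AllPairs using ([]; _∷_)
open import Data.List.Relation.Unary.Unique.Propositional using (Unique)
open import Data.Product using (Σ; ∃; _×_; _,_; proj₁; proj₂)
open import Data.Sum using (_⊎_; inj₁; inj₂; [_,_]′)
open import Data.Empty using (⊥; ⊥-elim)
open import Function using (_∘_)
open import Function.Bundles using (Injection; Equivalence)
open import Function.Definitions using (Injective)
open import Function.Properties.Inverse using (↔⇒↣)
open import Relation.Nullary using (¬_; Dec; yes; no)
open import Relation.Nullary.Decidable using (does; dec-true; dec-false)
open import Relation.Binary.PropositionalEquality
  using (_≡_; _≢_; refl; sym; trans; cong; cong₂; subst; module ≡-Reasoning)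
open import Relation.Binary.Definitions using (Tri; tri<; tri≈; tri>)
open import Algebra.Properties.CommutativeSemigroup ℕP.+-commutativeSemigroup using (x∙yz≈y∙xz)
open import Algebra.Properties.Semiring.Sum ℕP.+-*-semiring
  using (sum; sum-cong-≗; sum-replicate-zero; sum-permute; ∑-comm; ∑-distrib-+; *-distribˡ-sum; *-distribʳ-sum)

count-sum : ∀ {n} (f : Fin n → Bool) → count f ≡ sum (b2n ∘ f)
count-sum f = filter-tabulate f (λ i → i)
  where
  filter-tabulate : ∀ {n m} (P : Fin m → Bool) (g : Fin n → Fin m) →
    length (filter (λ w → T? (P w)) (tabulate g)) ≡ sum (b2n ∘ P ∘ g)
  filter-tabulate {zero} P g = refl
  filter-tabulate {suc n} P g with P (g zero) | filter-tabulate P (g ∘ suc)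
  ... | true  | ih = cong suc ih
  ... | false | ih = ih

count-cong : ∀ {n} {f g : Fin n → Bool} → (∀ i → f i ≡ g i) → count f ≡ count g
count-cong {f = f} {g} f≗g =
  trans (count-sum f) (trans (sum-cong-≗ (cong b2n ∘ f≗g)) (sym (count-sum g)))

count-permute : ∀ {n} (π : Permutation′ n) (f : Fin n → Bool) → count (f ∘ (π ⟨$⟩ʳ_)) ≡ count f
count-permute π f =
  trans (count-sum (f ∘ (π ⟨$⟩ʳ_))) (trans (sym (sum-permute (b2n ∘ f) π)) (sym (count-sum f)))

sum-mono : ∀ {n} {f g : Fin n → ℕ} → (∀ i → f i ≤ g i) → sum f ≤ sum g
sum-mono {zero} f≤g = z≤n
sum-mono {suc n} f≤g = ℕP.+-mono-≤ (f≤g zero) (sum-mono (f≤g ∘ suc))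

sum-ones : ∀ n → sum {n} (λ _ → 1) ≡ n
sum-ones zero = refl
sum-ones (suc n) = cong suc (sum-ones n)

remove : ∀ {n} → (Fin n → Bool) → Fin n → Fin n → Bool
remove f x i = if does (i ≟ x) then false else f i

removed : ∀ {n} (f : Fin n → Bool) x → remove f x x ≡ false
removed f x rewrite dec-true (x ≟ x) refl = refl

remove-other : ∀ {n} (f : Fin n → Bool) {x i} → i ≢ x → remove f x i ≡ f i
remove-other f {x} {i} i≢x rewrite dec-false (i ≟ x) i≢x = refl

count-remove : ∀ {n} (f : Fin n → Bool) x → count f ≡ b2n (f x) + count (remove f x)
count-remove f x = trans (count-sum f) (trans (split f x) (cong (b2n (f x) +_) (sym (count-sum (remove f x)))))
  where
  split : ∀ {n} (f : Fin n → Bool) x → sum (b2n ∘ f) ≡ b2n (f x) + sum (b2n ∘ remove f x)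
  split f zero = refl
  split f (suc x) = trans (cong (b2n (f zero) +_) (split (f ∘ suc) x))
                          (x∙yz≈y∙xz (b2n (f zero)) (b2n (f (suc x))) (sum (b2n ∘ remove (f ∘ suc) x)))

distinct-witnesses : ∀ {n} (f : Fin n → Bool) (xs : List (Fin n)) →
  Unique xs → All (λ x → f x ≡ true) xs → length xs ≤ count f
distinct-witnesses f [] [] [] = z≤n
distinct-witnesses f (x ∷ xs) (x∉xs ∷ unique) (fx ∷ fxs)
  rewrite count-remove f x | fx = s≤s (distinct-witnesses (remove f x) xs unique (still-true x∉xs fxs))
  where
  still-true : ∀ {ys} → All (x ≢_) ys → All (λ y → f y ≡ true) ys → All (λ y → remove f x y ≡ true) ys
  still-true [] [] = []
  still-true (x≢y ∷ x≢ys) (fy ∷ fys) = trans (remove-other f (x≢y ∘ sym)) fy ∷ still-true x≢ys fys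

witness : ∀ {n} (f : Fin n → Bool) → 1 ≤ count f → ∃ λ i → f i ≡ true
witness f pos = first f (subst (1 ≤_) (count-sum f) pos)
  where
  first : ∀ {n} (f : Fin n → Bool) → 1 ≤ sum (b2n ∘ f) → ∃ λ i → f i ≡ true
  first {suc n} f pos with f zero in fzero
  ... | true  = zero , fzero
  ... | false = let i , fi = first (f ∘ suc) pos in suc i , fi

witness-besides : ∀ {n} (f : Fin n → Bool) → 2 ≤ count f → ∀ x → ∃ λ i → i ≢ x × f i ≡ true
witness-besides {n} f two x = i , i≢x , trans (sym (remove-other f i≢x)) fi
  where
  rest : 1 ≤ count (remove f x)
  rest with f x | count-remove f x
  ... | true  | split = ℕ.s≤s⁻¹ (subst (2 ≤_) split two)
  ... | false | split = ℕP.≤-trans (s≤s z≤n) (subst (2 ≤_) split two)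
  found : ∃ λ i → remove f x i ≡ true
  found = witness (remove f x) rest
  i : Fin n
  i = proj₁ found
  fi : remove f x i ≡ true
  fi = proj₂ found
  i≢x : i ≢ x
  i≢x i≡x with trans (sym fi) (subst (λ j → remove f x j ≡ false) (sym i≡x) (removed f x))
  ... | ()

module Geodetic {n} {A : Digraph n} (G : TwoGeodetic A) where

  private
    too-many : ∀ u v → 2 ≤ walks0 u v + walks1 A u v + walks2 A u v → ⊥
    too-many u v two with ℕP.≤-trans two (G u v)
    ... | s≤s ()

    stay : ∀ (u : Fin n) → 1 ≤ walks0 u u
    stay u rewrite dec-true (u ≟ u) refl = s≤s z≤n

    step : ∀ {u v} → A u v ≡ true → 1 ≤ walks1 A u v
    step uv rewrite uv = s≤s z≤n

    two-steps : ∀ {u w v} → A u w ≡ true → A w v ≡ true → 1 ≤ walks2 A u v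
    two-steps {u} {w} {v} uw wv =
      distinct-witnesses (λ x → A u x ∧ A x v) (w ∷ []) ([] ∷ []) (cong₂ _∧_ uw wv ∷ [])

  no-loop : ∀ {x} → A x x ≡ true → ⊥
  no-loop {x} xx = too-many x x (ℕP.+-mono-≤ (ℕP.+-mono-≤ (stay x) (step xx)) z≤n)

  no-digon : ∀ {x y} → A x y ≡ true → A y x ≡ true → ⊥
  no-digon {x} xy yx = too-many x x (ℕP.+-mono-≤ (ℕP.+-mono-≤ (stay x) z≤n) (two-steps xy yx))

  no-shortcut : ∀ {x y z} → A x y ≡ true → A y z ≡ true → A x z ≡ true → ⊥
  no-shortcut {x} {z = z} xy yz xz = too-many x z (ℕP.+-mono-≤ (ℕP.+-mono-≤ {0} z≤n (step xz)) (two-steps xy yz))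

  unique-midpoint : ∀ {x y y′ z} → A x y ≡ true → A y z ≡ true → A x y′ ≡ true → A y′ z ≡ true → y ≡ y′
  unique-midpoint {x} {y} {y′} {z} xy yz xy′ y′z with y ≟ y′
  ... | yes y≡y′ = y≡y′
  ... | no y≢y′ = ⊥-elim (too-many x z (ℕP.+-mono-≤ {0} z≤n two-midpoints))
    where
    two-midpoints : 2 ≤ walks2 A x z
    two-midpoints = distinct-witnesses (λ w → A x w ∧ A w z) (y ∷ y′ ∷ [])
      ((y≢y′ ∷ []) ∷ [] ∷ []) (cong₂ _∧_ xy yz ∷ cong₂ _∧_ xy′ y′z ∷ [])

b2n-∧ : ∀ x y → b2n (x ∧ y) ≡ b2n x * b2n y
b2n-∧ true  true  = refl
b2n-∧ true  false = refl
b2n-∧ false y     = refl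

sum-walks0 : ∀ {n} (u : Fin n) → sum (walks0 u) ≡ 1
sum-walks0 {suc n} zero    = cong suc (sum-replicate-zero n)
sum-walks0 {suc n} (suc u) = sum-walks0 u

sum-walks2 : ∀ {n} (A : Digraph n) u → sum (walks2 A u) ≡ sum (λ w → b2n (A u w) * outDeg A w)
sum-walks2 A u = begin
  sum (walks2 A u)                                    ≡⟨ sum-cong-≗ (λ v → count-sum (λ w → A u w ∧ A w v)) ⟩
  sum (λ v → sum (λ w → b2n (A u w ∧ A w v)))         ≡⟨ sum-cong-≗ (λ v → sum-cong-≗ (λ w → b2n-∧ (A u w) (A w v))) ⟩
  sum (λ v → sum (λ w → b2n (A u w) * b2n (A w v)))   ≡⟨ ∑-comm (λ v w → b2n (A u w) * b2n (A w v)) ⟩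
  sum (λ w → sum (λ v → b2n (A u w) * b2n (A w v)))   ≡⟨ sum-cong-≗ (λ w → sym (*-distribˡ-sum (b2n (A u w)) (b2n ∘ A w))) ⟩
  sum (λ w → b2n (A u w) * sum (b2n ∘ A w))           ≡⟨ sum-cong-≗ (λ w → cong (b2n (A u w) *_) (sym (count-sum (A w)))) ⟩
  sum (λ w → b2n (A u w) * outDeg A w)                ∎
  where open ≡-Reasoning

-- In a 2-geodetic digraph every vertex is reached from u by at most one walk
-- of length ≤ 2, so the number of such walks is at most the order n.
moore-bound : ∀ {n} {A : Digraph n} → TwoGeodetic A → ∀ u →
  1 + outDeg A u + sum (λ w → b2n (A u w) * outDeg A w) ≤ n
moore-bound {n} {A} G u = begin
  1 + outDeg A u + sum (λ w → b2n (A u w) * outDeg A w)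
    ≡⟨ cong₂ _+_ (cong₂ _+_ (sym (sum-walks0 u)) (count-sum (A u))) (sym (sum-walks2 A u)) ⟩
  sum (walks0 u) + sum (walks1 A u) + sum (walks2 A u)
    ≡⟨ sym (trans (∑-distrib-+ _ (walks2 A u)) (cong (_+ sum (walks2 A u)) (∑-distrib-+ (walks0 u) (walks1 A u)))) ⟩
  sum (λ v → walks0 u v + walks1 A u v + walks2 A u v)
    ≤⟨ sum-mono (G u) ⟩
  sum {n} (λ _ → 1)
    ≡⟨ sum-ones n ⟩
  n ∎
  where open ℕP.≤-Reasoning

moore-bound-min : ∀ {n δ} {A : Digraph n} → TwoGeodetic A → MinOutDegAtLeast δ A → ∀ u →
  1 + outDeg A u + outDeg A u * δ ≤ n
moore-bound-min {n} {δ} {A} G M u =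
  ℕP.≤-trans (ℕP.+-monoʳ-≤ (1 + outDeg A u) grandchildren) (moore-bound G u)
  where
  grandchildren : outDeg A u * δ ≤ sum (λ w → b2n (A u w) * outDeg A w)
  grandchildren = begin
    outDeg A u * δ                   ≡⟨ cong (_* δ) (count-sum (A u)) ⟩
    sum (b2n ∘ A u) * δ              ≡⟨ *-distribʳ-sum δ (b2n ∘ A u) ⟩
    sum (λ w → b2n (A u w) * δ)      ≤⟨ sum-mono (λ w → ℕP.*-monoʳ-≤ (b2n (A u w)) (M w)) ⟩
    sum (λ w → b2n (A u w) * outDeg A w) ∎
    where open ℕP.≤-Reasoning

-- Order 9 = M(2,2) + 2 leaves no room for a vertex of out-degree 3.
outDeg-two : (A : Digraph 9) → TwoGeodetic A → MinOutDegAtLeast 2 A → ∀ u → outDeg A u ≡ 2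
outDeg-two A G M u with outDeg A u ℕ.≤? 2
... | yes d≤2 = ℕP.≤-antisym d≤2 (M u)
... | no d≰2 = ⊥-elim (ℕP.n≮n 9 (ℕP.≤-trans ten≤ (moore-bound-min G M u)))
  where
  three≤d : 3 ≤ outDeg A u
  three≤d = ℕP.≰⇒> d≰2
  ten≤ : 10 ≤ 1 + outDeg A u + outDeg A u * 2
  ten≤ = ℕP.+-mono-≤ (ℕP.+-monoʳ-≤ 1 three≤d) (ℕP.*-monoˡ-≤ 2 three≤d)

pair : ∀ {n} → Fin n → Fin n → Fin n → Bool
pair p q v = does (v ≟ p) ∨ does (v ≟ q)

pair-first : ∀ {n} (p q : Fin n) → pair p q p ≡ true
pair-first p q rewrite dec-true (p ≟ p) refl = refl

pair-second : ∀ {n} (p q : Fin n) → pair p q q ≡ true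
pair-second p q rewrite dec-true (q ≟ q) refl = ∨-comm _ true

OutPair : ∀ {n} → Digraph n → Fin n → Fin n → Fin n → Set
OutPair A u p q = p ≢ q × (∀ v → A u v ≡ pair p q v)

out-pair : ∀ {n} (A : Digraph n) u → outDeg A u ≡ 2 → Σ (Fin n) λ p → Σ (Fin n) λ q → p < q × OutPair A u p q
out-pair {n} A u deg≡2 = arrange (<-cmp a b)
  where
  two : 2 ≤ outDeg A u
  two = ℕP.≤-reflexive (sym deg≡2)
  first : ∃ λ a → A u a ≡ true
  first = witness (A u) (ℕP.≤-trans (s≤s z≤n) two)
  a : Fin n
  a = proj₁ first
  ua : A u a ≡ true
  ua = proj₂ first
  second : ∃ λ b → b ≢ a × A u b ≡ true
  second = witness-besides (A u) two a
  b : Fin n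
  b = proj₁ second
  b≢a : b ≢ a
  b≢a = proj₁ (proj₂ second)
  ub : A u b ≡ true
  ub = proj₂ (proj₂ second)

  -- a third out-neighbour v would make the out-degree at least 3
  exact : ∀ v → A u v ≡ pair a b v
  exact v with v ≟ a | v ≟ b
  ... | yes refl | _        = ua
  ... | no _     | yes refl = ub
  ... | no v≢a   | no v≢b with A u v in uv
  ...   | false = refl
  ...   | true  = ⊥-elim (ℕP.n≮n 2 (subst (3 ≤_) deg≡2 three))
    where
    three : 3 ≤ outDeg A u
    three = distinct-witnesses (A u) (a ∷ b ∷ v ∷ [])
      (((b≢a ∘ sym) ∷ (v≢a ∘ sym) ∷ []) ∷ ((v≢b ∘ sym) ∷ []) ∷ [] ∷ []) (ua ∷ ub ∷ uv ∷ [])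

  arrange : Tri (a < b) (a ≡ b) (b < a) → Σ (Fin n) λ p → Σ (Fin n) λ q → p < q × OutPair A u p q
  arrange (tri< a<b _ _) = a , b , a<b , <⇒≢ a<b , exact
  arrange (tri≈ _ a≡b _) = ⊥-elim (b≢a (sym a≡b))
  arrange (tri> _ _ b<a) = b , a , b<a , <⇒≢ b<a , λ v → trans (exact v) (∨-comm (does (v ≟ a)) (does (v ≟ b)))

relabel : ∀ {n} → Permutation′ n → Digraph n → Digraph n
relabel π A u v = A (π ⟨$⟩ʳ u) (π ⟨$⟩ʳ v)

module Relabel {n} (π : Permutation′ n) (A : Digraph n) where

  private
    σ : Fin n → Fin n
    σ = π ⟨$⟩ʳ_

    same-test : ∀ x y → does (σ x ≟ σ y) ≡ does (x ≟ y)
    same-test x y with x ≟ y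
    ... | yes refl = dec-true (σ x ≟ σ x) refl
    ... | no x≢y = dec-false (σ x ≟ σ y) (x≢y ∘ Injection.injective (↔⇒↣ π))

  geodetic : TwoGeodetic A → TwoGeodetic (relabel π A)
  geodetic G u v = subst (_≤ 1) same-walks (G (σ u) (σ v))
    where
    same-walks : walks0 (σ u) (σ v) + walks1 A (σ u) (σ v) + walks2 A (σ u) (σ v)
               ≡ walks0 u v + walks1 (relabel π A) u v + walks2 (relabel π A) u v
    same-walks = cong₂ _+_ (cong (λ b → b2n b + walks1 A (σ u) (σ v)) (same-test u v))
                           (sym (count-permute π (λ w → A (σ u) w ∧ A w (σ v))))

  min-outDeg : ∀ {δ} → MinOutDegAtLeast δ A → MinOutDegAtLeast δ (relabel π A)
  min-outDeg M u = subst (_ ≤_) (sym (count-permute π (A (σ u)))) (M (σ u))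

  numInDeg-same : ∀ k → numInDeg (relabel π A) k ≡ numInDeg A k
  numInDeg-same k = trans (count-cong (λ v → cong (λ d → does (d ℕ.≟ k)) (count-permute π (λ w → A w (σ v)))))
                          (count-permute π (λ v → does (inDeg A v ℕ.≟ k)))

  out-pair-moved : ∀ {u p q} → OutPair A (σ u) (σ p) (σ q) → OutPair (relabel π A) u p q
  out-pair-moved {u} {p} {q} (σp≢σq , row) =
    (σp≢σq ∘ cong σ) , λ v → trans (row (σ v)) (cong₂ _∨_ (same-test v p) (same-test v q))

transpose-hit : ∀ {n} (i j : Fin n) → PC.transpose i j i ≡ j
transpose-hit i j rewrite dec-true (i ≟ i) refl = refl

transpose-miss : ∀ {n} {i j k : Fin n} → k ≢ i → k ≢ j → PC.transpose i j k ≡ k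
transpose-miss {i = i} {j} {k} k≢i k≢j rewrite dec-false (k ≟ i) k≢i | dec-false (k ≟ j) k≢j = refl

extend-injection : ∀ {k n} (f : Fin k → Fin n) → Injective _≡_ _≡_ f → k ≤ n →
  Σ (Permutation′ n) λ π → ∀ i j → toℕ j ≡ toℕ i → π ⟨$⟩ʳ j ≡ f i
extend-injection {zero} f _ _ = id , λ ()
extend-injection {suc k} {n} f f-inj k<n = π ∘ₚ transpose (π ⟨$⟩ʳ slot) (f last) , placed
  where
  last : Fin (suc k)
  last = fromℕ k
  slot : Fin n
  slot = fromℕ< k<n
  earlier : Σ (Permutation′ n) λ π → ∀ i j → toℕ j ≡ toℕ i → π ⟨$⟩ʳ j ≡ f (inject₁ i)
  earlier = extend-injection (f ∘ inject₁) (λ e → inject₁-injective (f-inj e)) (ℕP.<⇒≤ k<n)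
  π : Permutation′ n
  π = proj₁ earlier

  -- first place the first k values by π, then swap the value at slot k into place
  placed : ∀ i j → toℕ j ≡ toℕ i → PC.transpose (π ⟨$⟩ʳ slot) (f last) (π ⟨$⟩ʳ j) ≡ f i
  placed i j j≡i with toℕ i ℕ.≟ k
  ... | yes i≡k = begin
    PC.transpose (π ⟨$⟩ʳ slot) (f last) (π ⟨$⟩ʳ j)     ≡⟨ cong (λ x → PC.transpose (π ⟨$⟩ʳ slot) (f last) (π ⟨$⟩ʳ x)) j≡slot ⟩
    PC.transpose (π ⟨$⟩ʳ slot) (f last) (π ⟨$⟩ʳ slot)  ≡⟨ transpose-hit (π ⟨$⟩ʳ slot) (f last) ⟩
    f last                                             ≡⟨ cong f (toℕ-injective (trans (toℕ-fromℕ k) (sym i≡k))) ⟩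
    f i                                                ∎
    where
    open ≡-Reasoning
    j≡slot : j ≡ slot
    j≡slot = toℕ-injective (trans j≡i (trans i≡k (sym (toℕ-fromℕ< k<n))))
  ... | no i≢k = trans (transpose-miss πj≢slot πj≢flast) πj≡fi
    where
    i′ : Fin k
    i′ = lower₁ i (i≢k ∘ sym)
    i≡i′ : inject₁ i′ ≡ i
    i≡i′ = inject₁-lower₁ i (i≢k ∘ sym)
    πj≡fi : π ⟨$⟩ʳ j ≡ f i
    πj≡fi = trans (proj₂ earlier i′ j (trans j≡i (trans (cong toℕ (sym i≡i′)) (toℕ-inject₁ i′)))) (cong f i≡i′)
    πj≢slot : π ⟨$⟩ʳ j ≢ π ⟨$⟩ʳ slot
    πj≢slot e = i≢k (trans (sym j≡i) (trans (cong toℕ (Injection.injective (↔⇒↣ π) e)) (toℕ-fromℕ< k<n)))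
    πj≢flast : π ⟨$⟩ʳ j ≢ f last
    πj≢flast e = i≢k (trans (cong toℕ (f-inj (trans (sym πj≡fi) e))) (toℕ-fromℕ k))

-- Positions in the out-tree of depth 2 below a vertex of out-degree 2.
data Node : Set where
  root       : Node
  child      : Fin 2 → Node
  grandchild : Fin 2 → Fin 2 → Node

-- In a 2-geodetic digraph the tree below any vertex r has no repeated vertex:
-- a repetition would be two different walks of length ≤ 2 from r.
module MooreTree {n} {A : Digraph n} (G : TwoGeodetic A)
  (r : Fin n) (c : Fin 2 → Fin n) (g : Fin 2 → Fin 2 → Fin n)
  (r→c : ∀ i → A r (c i) ≡ true) (c→g : ∀ i j → A (c i) (g i j) ≡ true)
  (c-inj : Injective _≡_ _≡_ c) (g-inj : ∀ i → Injective _≡_ _≡_ (g i)) where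

  open Geodetic G

  place : Node → Fin n
  place root             = r
  place (child i)        = c i
  place (grandchild i j) = g i j

  private
    retarget : ∀ {x y y′} → A x y ≡ true → y ≡ y′ → A x y′ ≡ true
    retarget xy refl = xy

    child≢grandchild : ∀ i i′ j → c i ≢ g i′ j
    child≢grandchild i i′ j e with i ≟ i′
    ... | yes refl = no-loop (retarget (c→g i j) (sym e))
    ... | no i≢i′ = no-shortcut (r→c i′) (c→g i′ j) (retarget (r→c i) e)

  place-injective : Injective _≡_ _≡_ place
  place-injective {root}           {root}             e = refl
  place-injective {root}           {child i}          e = ⊥-elim (no-loop (retarget (r→c i) (sym e)))
  place-injective {root}           {grandchild i j}   e = ⊥-elim (no-digon (r→c i) (retarget (c→g i j) (sym e)))
  place-injective {child i}        {root}             e = ⊥-elim (no-loop (retarget (r→c i) e))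
  place-injective {child i}        {child i′}         e = cong child (c-inj e)
  place-injective {child i}        {grandchild i′ j}  e = ⊥-elim (child≢grandchild i i′ j e)
  place-injective {grandchild i j} {root}             e = ⊥-elim (no-digon (r→c i) (retarget (c→g i j) e))
  place-injective {grandchild i j} {child i′}         e = ⊥-elim (child≢grandchild i′ i j (sym e))
  place-injective {grandchild i j} {grandchild i′ j′} e with i ≟ i′
  ... | yes refl = cong (grandchild i) (g-inj i e)
  ... | no i≢i′ = ⊥-elim (i≢i′ (c-inj (unique-midpoint (r→c i) (c→g i j) (r→c i′) (retarget (c→g i′ j′) (sym e)))))

node : Fin 7 → Node
node zero                                     = root
node (suc zero)                               = child zero
node (suc (suc zero))                         = child (suc zero)
node (suc (suc (suc zero)))                   = grandchild zero zero
node (suc (suc (suc (suc zero))))             = grandchild zero (suc zero)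
node (suc (suc (suc (suc (suc zero)))))       = grandchild (suc zero) zero
node (suc (suc (suc (suc (suc (suc zero)))))) = grandchild (suc zero) (suc zero)

node-injective : Injective _≡_ _≡_ node
node-injective {i} {j} e = trans (sym (index-node i)) (trans (cong index e) (index-node j))
  where
  index : Node → Fin 7
  index root                          = # 0
  index (child zero)                  = # 1
  index (child (suc zero))            = # 2
  index (grandchild zero zero)        = # 3
  index (grandchild zero (suc zero))  = # 4
  index (grandchild (suc zero) zero)  = # 5
  index (grandchild (suc zero) (suc zero)) = # 6
  index-node : ∀ i → index (node i) ≡ i
  index-node zero                                     = refl
  index-node (suc zero)                               = refl
  index-node (suc (suc zero))                         = refl
  index-node (suc (suc (suc zero)))                   = refl
  index-node (suc (suc (suc (suc zero))))             = refl
  index-node (suc (suc (suc (suc (suc zero)))))       = refl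
  index-node (suc (suc (suc (suc (suc (suc zero)))))) = refl

Row : Set
Row = Fin 9 × Fin 9

-- For each vertex, its out-pair if already chosen.
Partial : Set
Partial = Vec (Maybe Row) 9

Agrees : Digraph 9 → Partial → Set
Agrees B P = ∀ u p q → lookup P u ≡ just (p , q) → OutPair B u p q

agrees-update : ∀ {B P i p q} → Agrees B P → OutPair B i p q → Agrees B (P [ i ]≔ just (p , q))
agrees-update {P = P} {i} {p} {q} agrees row u p′ q′ chosen with u ≟ i
... | yes refl with trans (sym (lookup∘update u P (just (p , q)))) chosen
...   | refl = row
agrees-update {P = P} {i} {p} {q} agrees row u p′ q′ chosen
    | no u≢i = agrees u p′ q′ (trans (sym (lookup∘update′ u≢i P (just (p , q)))) chosen)

start : Partial
start = just (# 1 , # 2) ∷ just (# 3 , # 4) ∷ just (# 5 , # 6) ∷ replicate 6 nothing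

module OrderNine (A : Digraph 9) (G : TwoGeodetic A) (M : MinOutDegAtLeast 2 A) where

  out-pairs : ∀ u → Σ (Fin 9) λ p → Σ (Fin 9) λ q → p < q × OutPair A u p q
  out-pairs u = out-pair A u (outDeg-two A G M u)

  out : Fin 9 → Fin 2 → Fin 9
  out u zero       = proj₁ (out-pairs u)
  out u (suc zero) = proj₁ (proj₂ (out-pairs u))

  out-row : ∀ u → OutPair A u (out u zero) (out u (suc zero))
  out-row u = proj₂ (proj₂ (proj₂ (out-pairs u)))

  out-arc : ∀ u i → A u (out u i) ≡ true
  out-arc u zero       = trans (proj₂ (out-row u) (out u zero)) (pair-first (out u zero) (out u (suc zero)))
  out-arc u (suc zero) = trans (proj₂ (out-row u) (out u (suc zero))) (pair-second (out u zero) (out u (suc zero)))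

  out-injective : ∀ u → Injective _≡_ _≡_ (out u)
  out-injective u {zero}     {zero}     _ = refl
  out-injective u {zero}     {suc zero} e = ⊥-elim (proj₁ (out-row u) e)
  out-injective u {suc zero} {zero}     e = ⊥-elim (proj₁ (out-row u) (sym e))
  out-injective u {suc zero} {suc zero} _ = refl

  -- the root of the Moore tree; any vertex would do
  r : Fin 9
  r = # 0

  open MooreTree G r (out r) (λ i → out (out r i)) (out-arc r) (λ i → out-arc (out r i))
                 (out-injective r) (λ i → out-injective (out r i))

  tree : Fin 7 → Fin 9
  tree = place ∘ node

  -- relabel so that the Moore tree below r occupies the vertices 0,…,6
  -- (opaque: only its defining property is used, and unfolding it is costly)
  opaque
    relabelling : Σ (Permutation′ 9) λ π → ∀ i j → toℕ j ≡ toℕ i → π ⟨$⟩ʳ j ≡ tree i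
    relabelling = extend-injection tree (λ e → node-injective (place-injective e)) (ℕP.m≤m+n 7 2)

  π : Permutation′ 9
  π = proj₁ relabelling

  private
    moved-row : ∀ {u p q : Fin 9} (x y z : Fin 7) → toℕ u ≡ toℕ x → toℕ p ≡ toℕ y → toℕ q ≡ toℕ z →
                OutPair A (tree x) (tree y) (tree z) → OutPair (relabel π A) u p q
    moved-row {u} {p} {q} x y z ux py qz row =
      Relabel.out-pair-moved π A (transport (proj₂ relabelling x u ux) (proj₂ relabelling y p py) (proj₂ relabelling z q qz))
      where
      transport : ∀ {u′ p′ q′} → u′ ≡ tree x → p′ ≡ tree y → q′ ≡ tree z → OutPair A u′ p′ q′
      transport refl refl refl = row

  normal-form : Agrees (relabel π A) start
  normal-form zero                _ _ refl = moved-row (# 0) (# 1) (# 2) refl refl refl (out-row r)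
  normal-form (suc zero)          _ _ refl = moved-row (# 1) (# 3) (# 4) refl refl refl (out-row (out r zero))
  normal-form (suc (suc zero))    _ _ refl = moved-row (# 2) (# 5) (# 6) refl refl refl (out-row (out r (suc zero)))
  normal-form (suc (suc (suc u))) _ _ recorded with trans (sym (lookup-replicate u nothing)) recorded
  ... | ()

every : (Fin 9 → Bool) → Bool
every f = does (all? (T? ∘ f))

some : (Fin 9 → Bool) → Bool
some f = does (any? (T? ∘ f))

rowArcs : Maybe Row → Fin 9 → Bool
rowArcs (just (p , q)) = pair p q
rowArcs nothing        = λ _ → false

known : Partial → Digraph 9
known P u = rowArcs (lookup P u)

shares : Maybe Row → (Fin 9 → Bool) → Bool
shares (just (c , d)) f = f c ∨ f d
shares nothing        f = false

-- The recorded arcs at u with out-pair {a, b} already force two walks of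
-- length ≤ 2 with the same ends: a loop u → u, a digon u → a → u or
-- u → b → u, an arc u → b parallel to u → a → b (or symmetrically), or a
-- common out-neighbour of a and b.
clashRow : Partial → Fin 9 → Maybe Row → Bool
clashRow P u nothing        = false
clashRow P u (just (a , b)) =
  pair a b u ∨ K a u ∨ K b u ∨ K a b ∨ K b a ∨ shares (lookup P a) (K b)
  where
  K : Digraph 9
  K = known P

clash : Partial → Fin 9 → Bool
clash P u = clashRow P u (lookup P u)

settled : Partial → Bool
settled P = every (λ u → is-just (lookup P u))

-- 'refuted vs P' holds if every way of choosing ordered out-pairs for the
-- vertices vs, on top of P, either clashes or ends with a digraph whose
-- number of vertices of in-degree 1 is not 2.
mutual
  refuted : List (Fin 9) → Partial → Bool
  refuted []       P = settled P ∧ not (does (numInDeg (known P) 1 ℕ.≟ 2))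
  refuted (i ∷ vs) P = every λ p → every λ q → choose vs P i p q

  choose : List (Fin 9) → Partial → Fin 9 → Fin 9 → Fin 9 → Bool
  choose vs P i p q = if toℕ p <ᵇ toℕ q then some (clash P′) ∨ refuted vs P′ else true
    where
    P′ : Partial
    P′ = P [ i ]≔ just (p , q)

unassigned : List (Fin 9)
unassigned = # 3 ∷ # 4 ∷ # 5 ∷ # 6 ∷ # 7 ∷ # 8 ∷ []

search-exhausted : refuted unassigned start ≡ true
search-exhausted = refl

T⇒≡ : ∀ {b} → T b → b ≡ true
T⇒≡ = Equivalence.to T-≡

≡⇒T : ∀ {b} → b ≡ true → T b
≡⇒T = Equivalence.from T-≡

T-split : ∀ {x y} → T (x ∨ y) → T x ⊎ T y
T-split = Equivalence.to T-∨

decided : ∀ {A : Set} (a? : Dec A) → T (does a?) → A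
decided (yes a) _ = a
decided (no _)  ()

every-sound : ∀ f → T (every f) → ∀ i → T (f i)
every-sound f = decided (all? (T? ∘ f))

some-sound : ∀ f → T (some f) → ∃ λ i → T (f i)
some-sound f = decided (any? (T? ∘ f))

if-taken : ∀ {c x} → T c → T (if c then x else true) → T x
if-taken {true} _ h = h

numInDeg-cong : ∀ {n} {A A′ : Digraph n} → (∀ u v → A u v ≡ A′ u v) → ∀ k → numInDeg A k ≡ numInDeg A′ k
numInDeg-cong A≗A′ k = count-cong (λ v → cong (λ d → does (d ℕ.≟ k)) (count-cong (λ u → A≗A′ u v)))

shares-sound : ∀ {f} (m : Maybe Row) → T (shares m f) → ∃ λ w → T (rowArcs m w) × T (f w)
shares-sound (just (c , d)) h with T-split h
... | inj₁ fc = c , ≡⇒T (pair-first c d) , fc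
... | inj₂ fd = d , ≡⇒T (pair-second c d) , fd

module Refutation (B : Digraph 9) (G : TwoGeodetic B) (M : MinOutDegAtLeast 2 B)
                  (two-of-in-degree-1 : numInDeg B 1 ≡ 2) where

  open Geodetic G
  open OrderNine B G M using (out-pairs)

  arc : ∀ P → Agrees B P → ∀ {u v} → T (known P u v) → B u v ≡ true
  arc P agrees {u} {v} h with lookup P u in chosen
  ... | just (p , q) = trans (proj₂ (agrees u p q chosen) v) (T⇒≡ h)
  ... | nothing      = ⊥-elim h

  -- each disjunct of 'clashRow' is one of the configurations excluded by 'Geodetic'
  clash-sound : ∀ P → Agrees B P → ∀ u → T (clash P u) → ⊥
  clash-sound P agrees u h with lookup P u in chosen
  ... | just (a , b) =
    [ loop , [ digon a ua , [ digon b ub , [ shortcut ua ub , [ shortcut ub ua , common-out-neighbour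
    ]′ ∘ T-split ]′ ∘ T-split ]′ ∘ T-split ]′ ∘ T-split ]′ (T-split h)
    where
    row : ∀ v → B u v ≡ pair a b v
    row = proj₂ (agrees u a b chosen)
    ua : B u a ≡ true
    ua = trans (row a) (pair-first a b)
    ub : B u b ≡ true
    ub = trans (row b) (pair-second a b)

    loop : T (pair a b u) → ⊥
    loop uu = no-loop (trans (row u) (T⇒≡ uu))
    digon : ∀ x → B u x ≡ true → T (known P x u) → ⊥
    digon x ux xu = no-digon ux (arc P agrees xu)
    shortcut : ∀ {x y} → B u x ≡ true → B u y ≡ true → T (known P x y) → ⊥
    shortcut ux uy xy = no-shortcut ux (arc P agrees xy) uy
    common-out-neighbour : T (shares (lookup P a) (known P b)) → ⊥
    common-out-neighbour h with shares-sound (lookup P a) h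
    ... | w , aw , bw = proj₁ (agrees u a b chosen) (unique-midpoint ua (arc P agrees aw) ub (arc P agrees bw))

  settled-known : ∀ P → Agrees B P → T (settled P) → ∀ u v → B u v ≡ known P u v
  settled-known P agrees all-set u v with lookup P u in chosen | every-sound (λ u → is-just (lookup P u)) all-set u
  ... | just (p , q) | _ = proj₂ (agrees u p q chosen) v

  -- Follow the branch of B's own out-pair for each vertex: it cannot clash, and
  -- at the leaf the recorded digraph is B, which has two vertices of in-degree 1.
  refuted-sound : ∀ vs P → Agrees B P → refuted vs P ≡ true → ⊥
  refuted-sound [] P agrees h with Equivalence.to (T-∧ {settled P}) (≡⇒T h)
  ... | all-set , not-two =
    subst (λ m → T (not (does (m ℕ.≟ 2))))
          (trans (sym (numInDeg-cong (settled-known P agrees all-set) 1)) two-of-in-degree-1) not-two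
  refuted-sound (i ∷ vs) P agrees h with out-pairs i
  ... | p , q , p<q , row =
    [ (λ clashes → let u , c = some-sound (clash P′) clashes in clash-sound P′ agrees′ u c)
    , refuted-sound vs P′ agrees′ ∘ T⇒≡
    ]′ (T-split (if-taken (ℕP.<⇒<ᵇ p<q) chosen))
    where
    P′ : Partial
    P′ = P [ i ]≔ just (p , q)
    agrees′ : Agrees B P′
    agrees′ = agrees-update {P = P} agrees row
    chosen : T (choose vs P i p q)
    chosen = every-sound (choose vs P i p) (every-sound (λ p → every (choose vs P i p)) (≡⇒T h) p) q

theorem7 : (A : Digraph 9) → TwoGeodetic A → MinOutDegAtLeast 2 A →
           ¬ (numInDeg A 1 ≡ 2 × numInDeg A 3 ≡ 2 × numInDeg A 2 ≡ 5)
theorem7 A G M (two-of-in-degree-1 , _ , _) =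
  Refutation.refuted-sound B (Relabel.geodetic π A G) (Relabel.min-outDeg π A M)
    (trans (Relabel.numInDeg-same π A 1) two-of-in-degree-1)
    unassigned start normal-form search-exhausted
  where
  open OrderNine A G M using (π; normal-form)
  B : Digraph 9
  B = relabel π A
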